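{- For every non-negative integer $k$ that is not prime, $g(\bar{g}(k)) = k$.
   Context: A square-product sequence is a strictly increasing finite sequence of integers $a_1 < \cdots < a_t$ ($t \geq 1$) whose product is a perfect square. For a non-negative integer $n$, $g(n)$ is the least integer $k$ such that there is a square-product sequence $n = a_1 < \cdots < a_t = k$. For a non-negative integer $k$, $\bar{g}(k)$ is the greatest integer $n$ such that there exists a square-product sequence $n = a_1 < \cdots < a_t = k$. -}

module Defs where

open import Data.Nat using (ℕ; _*_; _<_; _≤_)
open import Data.List using (List; _∷_; last)
open import Data.Nat.ListAction using (product)
open import Data.List.Relation.Unary.Linked using (Linked)
open import Data.Maybe using (just)
open import Data.Product using (Σ; ∃; _×_)
open import Relation.Binary.PropositionalEquality using (_≡_)

-- p is a perfect square (terms are ≥ n ≥ 0, so all integers involved are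
-- naturals; a square of an integer m equals the square of |m| ∈ ℕ)
IsSquare : ℕ → Set
IsSquare p = ∃ λ m → m * m ≡ p

-- A square-product sequence n = a₁ < ⋯ < a_t = k (t ≥ 1), written as the
-- nonempty list  n ∷ rest :  strictly increasing, last element k,
-- product a perfect square.
SqProdSeq : ℕ → ℕ → Set
SqProdSeq n k = Σ (List ℕ) λ rest →
  Linked _<_ (n ∷ rest) × last (n ∷ rest) ≡ just k × IsSquare (product (n ∷ rest))

IsG : ℕ → ℕ → Set
IsG n k = SqProdSeq n k × (∀ k′ → SqProdSeq n k′ → k ≤ k′)

IsGbar : ℕ → ℕ → Set
IsGbar k n = SqProdSeq n k × (∀ n′ → SqProdSeq n′ k → n′ ≤ n)

-- Let n = ḡ(k) and suppose a square-product sequence runs from n to some k′ < k. Together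
-- with one from n to k, the symmetric difference D of the two tails (the terms after n)
-- has square product: the two products multiply to prod D times the square of n times the
-- common terms, and n > 0. D is strictly increasing, lies above n, and ends at k, because
-- every term of the shorter sequence is at most k′. So D is a square-product sequence to k
-- starting above n, contradicting the maximality of n. As for n > 0: a non-prime k > 0 is
-- reached from a positive start, 1 by [1] and k = d q with 1 < d < k by d < q < k,
-- q < d < k, or k = d².
module Submission where

open import Defs
open import Data.Nat using (ℕ)
open import Data.Nat.Primality using (Prime)
open import Relation.Nullary using (¬_)

open import Data.Nat.Base
  using (NonZero; _*_; _<_; _≤_; suc; z≤n; z<s; >-nonZero; >-nonZero⁻¹; ≢-nonZero; ≢-nonZero⁻¹; nonTrivial⇒n>1)
open import Data.Nat.Properties
open import Data.Nat.Divisibility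
  using (divides; ∣-refl; quotient; quotient-<; quotient≢0; m∣n⇒n≡quotient*m; m∣n⇒n≡m*quotient)
open import Data.Nat.DivMod using (_/_; m/n*n≡m)
open import Data.Nat.GCD using (gcd; gcd[m,n]∣m; gcd[m,n]∣n; gcd[m,n]≢0)
open import Data.Nat.Coprimality using (Coprime; coprime-/gcd; coprime-divisor)
open import Data.Nat.Primality using (¬prime⇒composite; composite)
open import Data.Nat.ListAction using (product)
open import Data.Nat.ListAction.Properties using (product≢0)
open import Algebra.Properties.CommutativeSemigroup *-commutativeSemigroup using (x∙yz≈y∙xz)
open import Data.List.Base using (List; []; _∷_; last)
open import Data.List.Relation.Unary.All as All using (All; []; _∷_)
open import Data.List.Relation.Unary.Linked using (Linked; []; [-]; _∷_)
open import Data.List.Relation.Unary.Linked.Properties using (Linked⇒All)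
open import Data.Maybe.Base using (just)
open import Data.Maybe.Properties using (just-injective)
open import Data.Product.Base using (∃; _×_; _,_; proj₁; proj₂)
open import Data.Sum.Base using (inj₁)
open import Data.Empty using (⊥-elim)
open import Relation.Binary.Definitions using (Tri; tri<; tri≈; tri>)
open import Relation.Binary.PropositionalEquality
  using (_≡_; _≢_; refl; sym; trans; cong; subst; module ≡-Reasoning)

open ≡-Reasoning

IsSquare-* : ∀ {a b} → IsSquare a → IsSquare b → IsSquare (a * b)
IsSquare-* (r , refl) (s , refl) = r * s , [m*n]*[o*p]≡[m*o]*[n*p] r s r s

-- Writing d = d′ g and y = y′ g with g = gcd d y, the equation x d′² = y′² with
-- d′, y′ coprime forces d′ ∣ y′, hence d′ = 1.
IsSquare-cancelʳ : ∀ x d .{{_ : NonZero d}} → IsSquare (x * (d * d)) → IsSquare x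
IsSquare-cancelʳ x d (y , y²≡xd²) = y′ , sym x≡y′²
  where
  g = gcd d y
  instance
    g≢0 : NonZero g
    g≢0 = ≢-nonZero (gcd[m,n]≢0 d y (inj₁ (≢-nonZero⁻¹ d)))
  d′ y′ : ℕ
  d′ = d / g
  y′ = y / g
  coprime : Coprime d′ y′
  coprime = coprime-/gcd d y
  reduced : x * (d′ * d′) ≡ y′ * y′
  reduced = *-cancelʳ-≡ _ _ (g * g) {{m*n≢0 g g}} (begin
    x * (d′ * d′) * (g * g)     ≡⟨ *-assoc x _ _ ⟩
    x * (d′ * d′ * (g * g))     ≡⟨ cong (x *_) ([m*n]*[o*p]≡[m*o]*[n*p] d′ g d′ g) ⟨
    x * (d′ * g * (d′ * g))     ≡⟨ cong (λ t → x * (t * t)) (m/n*n≡m (gcd[m,n]∣m d y)) ⟩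
    x * (d * d)                 ≡⟨ y²≡xd² ⟨
    y * y                       ≡⟨ cong (λ t → t * t) (m/n*n≡m (gcd[m,n]∣n d y)) ⟨
    y′ * g * (y′ * g)           ≡⟨ [m*n]*[o*p]≡[m*o]*[n*p] y′ g y′ g ⟩
    y′ * y′ * (g * g)           ∎)
  d′≡1 : d′ ≡ 1
  d′≡1 = coprime (∣-refl , coprime-divisor coprime
    (divides (x * d′) (trans (sym reduced) (sym (*-assoc x d′ d′)))))
  x≡y′² : x ≡ y′ * y′
  x≡y′² = trans (sym (*-identityʳ x)) (trans (cong (λ t → x * (t * t)) (sym d′≡1)) reduced)

*-pullˡ : ∀ a {p q s t} → p * q ≡ s * t → a * p * q ≡ a * s * t
*-pullˡ a {p} {q} {s} {t} pq≡st = begin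
  a * p * q    ≡⟨ *-assoc a p q ⟩
  a * (p * q)  ≡⟨ cong (a *_) pq≡st ⟩
  a * (s * t)  ≡⟨ *-assoc a s t ⟨
  a * s * t    ∎

*-pullʳ : ∀ a {p q s t} → p * q ≡ s * t → p * (a * q) ≡ a * s * t
*-pullʳ a {p} {q} {s} {t} pq≡st = begin
  p * (a * q)  ≡⟨ x∙yz≈y∙xz p a q ⟩
  a * (p * q)  ≡⟨ cong (a *_) pq≡st ⟩
  a * (s * t)  ≡⟨ *-assoc a s t ⟨
  a * s * t    ∎

common-factor-square : ∀ a {b} p q s c → a ≡ b → p * q ≡ s * (c * c) →
                       a * p * (b * q) ≡ s * (a * c * (a * c))
common-factor-square a p q s c refl pq≡sc² = begin
  a * p * (a * q)          ≡⟨ [m*n]*[o*p]≡[m*o]*[n*p] a p a q ⟩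
  a * a * (p * q)          ≡⟨ cong (a * a *_) pq≡sc² ⟩
  a * a * (s * (c * c))    ≡⟨ x∙yz≈y∙xz (a * a) s (c * c) ⟩
  s * (a * a * (c * c))    ≡⟨ cong (s *_) ([m*n]*[o*p]≡[m*o]*[n*p] a c a c) ⟨
  s * (a * c * (a * c))    ∎

Linked-skip : ∀ {lo x : ℕ} {xs} → lo < x → Linked _<_ (x ∷ xs) → Linked _<_ (lo ∷ xs)
Linked-skip lo<x [-]            = [-]
Linked-skip lo<x (x<y ∷ y↗ys) = <-trans lo<x x<y ∷ y↗ys

Linked-last⇒All≤ : ∀ {xs m} → Linked _<_ xs → last xs ≡ just m → All (_≤ m) xs
Linked-last⇒All≤ [-]            refl = ≤-refl ∷ []
Linked-last⇒All≤ (x<y ∷ y↗ys) eq = <⇒≤ (<-≤-trans x<y (All.head ys≤m)) ∷ ys≤m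
  where ys≤m = Linked-last⇒All≤ y↗ys eq

last-∷-≢ : ∀ {A : Set} {lo x k : A} ys → x ≢ k → last (x ∷ ys) ≡ just k →
           last (lo ∷ ys) ≡ just k
last-∷-≢ []      x≢k eq = ⊥-elim (x≢k (just-injective eq))
last-∷-≢ (_ ∷ _) _   eq = eq

select : ∀ {A P Q R : Set} → Tri P Q R → A → A → A → A
select (tri< _ _ _) a _ _ = a
select (tri≈ _ _ _) _ b _ = b
select (tri> _ _ _) _ _ c = c

select-elim : ∀ {A P Q R : Set} (C : A → Set) (t : Tri P Q R) {a b c : A} →
              (P → C a) → (Q → C b) → (R → C c) → C (select t a b c)
select-elim C (tri< p _ _) f _ _ = f p
select-elim C (tri≈ _ q _) _ g _ = g q
select-elim C (tri> _ _ r) _ _ h = h r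

infixr 6 _△_

-- The comparison goes
-- through select rather than with, so that termination checking sees the recursive calls
-- as lexicographically decreasing.
_△_ : List ℕ → List ℕ → List ℕ
[]       △ ys       = ys
(x ∷ xs) △ []       = x ∷ xs
(x ∷ xs) △ (y ∷ ys) = select (<-cmp x y) (x ∷ xs △ (y ∷ ys)) (xs △ ys) (y ∷ (x ∷ xs) △ ys)

△-linked : ∀ {lo xs ys} → Linked _<_ (lo ∷ xs) → Linked _<_ (lo ∷ ys) →
           Linked _<_ (lo ∷ xs △ ys)
△-linked {xs = []}         _     lo↗ys = lo↗ys
△-linked {xs = _ ∷ _} {[]} lo↗xs _     = lo↗xs
△-linked {lo} {x ∷ _} {y ∷ _} (lo<x ∷ x↗xs) (lo<y ∷ y↗ys) =
  select-elim (λ D → Linked _<_ (lo ∷ D)) (<-cmp x y)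
    (λ x<y → lo<x ∷ △-linked x↗xs (x<y ∷ y↗ys))
    (λ _   → △-linked (Linked-skip lo<x x↗xs) (Linked-skip lo<y y↗ys))
    (λ y<x → lo<y ∷ △-linked (y<x ∷ x↗xs) y↗ys)

last-△ : ∀ {lo k} xs ys → All (_< k) (lo ∷ xs) → last (lo ∷ ys) ≡ just k →
         last (lo ∷ xs △ ys) ≡ just k
last-△ []      ys _          eq   = eq
last-△ (_ ∷ _) [] (lo<k ∷ _) refl = ⊥-elim (<-irrefl refl lo<k)
last-△ {lo} {k} (x ∷ xs) (y ∷ ys) (lo<k ∷ x<k ∷ xs<k) eq =
  select-elim (λ D → last (lo ∷ D) ≡ just k) (<-cmp x y)
    (λ _   → last-△ xs (y ∷ ys) (x<k ∷ xs<k) eq)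
    (λ x≡y → last-△ xs ys (lo<k ∷ xs<k) (last-∷-≢ ys (<⇒≢ (subst (_< k) x≡y x<k)) eq))
    (λ y<x → last-△ (x ∷ xs) ys (<-trans y<x x<k ∷ x<k ∷ xs<k) eq)

-- The witness c is the product of the common elements.
product-△ : ∀ xs ys → ∃ λ c → product xs * product ys ≡ product (xs △ ys) * (c * c)
product-△ []       ys       = 1 , trans (*-identityˡ _) (sym (*-identityʳ _))
product-△ (x ∷ xs) []       = 1 , refl
product-△ (x ∷ xs) (y ∷ ys) =
  select-elim (λ D → ∃ λ c → product (x ∷ xs) * product (y ∷ ys) ≡ product D * (c * c)) (<-cmp x y)
    (λ _   → let c , e = product-△ xs (y ∷ ys) in c , *-pullˡ x e)
    (λ x≡y → let c , e = product-△ xs ys in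
             x * c , common-factor-square x (product xs) (product ys) (product (xs △ ys)) c x≡y e)
    (λ _   → let c , e = product-△ (x ∷ xs) ys in c , *-pullʳ y {product (x ∷ xs)} e)

IsSquare-△ : ∀ n xs ys → {{NonZero (product (n ∷ xs) * product (n ∷ ys))}} →
             IsSquare (product (n ∷ xs)) → IsSquare (product (n ∷ ys)) → IsSquare (product (xs △ ys))
IsSquare-△ n xs ys {{nonZero}} □xs □ys =
  IsSquare-cancelʳ (product (xs △ ys)) (n * c) {{nc≢0}} (subst IsSquare split (IsSquare-* □xs □ys))
  where
  c = proj₁ (product-△ xs ys)
  split : product (n ∷ xs) * product (n ∷ ys) ≡ product (xs △ ys) * (n * c * (n * c))
  split = common-factor-square n (product xs) (product ys) (product (xs △ ys)) c refl
            (proj₂ (product-△ xs ys))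
  nc≢0 : NonZero (n * c)
  nc≢0 = m*n≢0⇒m≢0 (n * c) {{m*n≢0⇒n≢0 (product (xs △ ys)) {{subst NonZero split nonZero}}}}

square⇒SqProdSeq : ∀ {k} → IsSquare k → SqProdSeq k k
square⇒SqProdSeq {k} (r , r²≡k) = [] , [-] , refl , r , trans r²≡k (sym (*-identityʳ k))

divisorPair⇒SqProdSeq : ∀ {d q k} → d < q → q < k → d * q ≡ k → SqProdSeq d k
divisorPair⇒SqProdSeq {d} {q} d<q q<dq refl =
  q ∷ d * q ∷ [] , d<q ∷ q<dq ∷ [-] , refl ,
  d * q , trans (*-assoc d q (d * q)) (cong (λ t → d * (q * t)) (sym (*-identityʳ (d * q))))

nonPrime⇒positiveSqProdSeq : ∀ {k} → 0 < k → ¬ Prime k → ∃ λ m → 0 < m × SqProdSeq m k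
nonPrime⇒positiveSqProdSeq {1} _ _ = 1 , z<s , square⇒SqProdSeq (1 , refl)
nonPrime⇒positiveSqProdSeq {k@(suc (suc _))} _ ¬prime with ¬prime⇒composite ¬prime
... | composite {d} d<k d∣k with <-cmp d (quotient d∣k)
...   | tri< d<q _ _ = d , <-trans z<s (nonTrivial⇒n>1 d) ,
        divisorPair⇒SqProdSeq d<q (quotient-< d∣k) (sym (m∣n⇒n≡m*quotient d∣k))
...   | tri≈ _ d≡q _ = k , z<s ,
        square⇒SqProdSeq (d , trans (cong (_* d) d≡q) (sym (m∣n⇒n≡quotient*m d∣k)))
...   | tri> _ _ q<d = quotient d∣k , >-nonZero⁻¹ _ {{quotient≢0 d∣k}} ,
        divisorPair⇒SqProdSeq q<d d<k (sym (m∣n⇒n≡quotient*m d∣k))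

Linked-positive⇒All≢0 : ∀ {n xs} → 0 < n → Linked _<_ (n ∷ xs) → All NonZero (n ∷ xs)
Linked-positive⇒All≢0 0<n n↗xs = All.map >-nonZero (Linked⇒All <-trans 0<n n↗xs)

SqProdSeq-exchange : ∀ {n k k′} → 0 < n → k′ < k → SqProdSeq n k → SqProdSeq n k′ →
                     ∃ λ x → n < x × SqProdSeq x k
SqProdSeq-exchange {n} {k} 0<n k′<k (as , n↗as , last-as , □as) (bs , n↗bs , last-bs , □bs) =
  fromTail (bs △ as) (△-linked n↗bs n↗as) (last-△ bs as bs<k last-as) □D
  where
  bs<k : All (_< k) (n ∷ bs)
  bs<k = All.map (λ b≤k′ → ≤-<-trans b≤k′ k′<k) (Linked-last⇒All≤ n↗bs last-bs)
  instance
    nonZero : NonZero (product (n ∷ bs) * product (n ∷ as))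
    nonZero = m*n≢0 _ _ {{product≢0 (Linked-positive⇒All≢0 0<n n↗bs)}}
                        {{product≢0 (Linked-positive⇒All≢0 0<n n↗as)}}
  □D : IsSquare (product (bs △ as))
  □D = IsSquare-△ n bs as □bs □as
  fromTail : ∀ D → Linked _<_ (n ∷ D) → last (n ∷ D) ≡ just k → IsSquare (product D) →
             ∃ λ x → n < x × SqProdSeq x k
  fromTail []      _           n≡k    _  = ⊥-elim (<-irrefl (just-injective n≡k) (All.head bs<k))
  fromTail (x ∷ r) (n<x ∷ x↗r) last-r □r = x , n<x , r , x↗r , last-r , □r

lemma1p12 : (k : ℕ) → ¬ Prime k → (n : ℕ) → IsGbar k n → IsG n k
lemma1p12 k ¬prime n (seqₖ , maximal) = seqₖ , minimal
  where
  minimal : ∀ k′ → SqProdSeq n k′ → k ≤ k′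
  minimal k′ seq′ = ≮⇒≥ λ k′<k →
    let m , 0<m , seqₘ = nonPrime⇒positiveSqProdSeq (≤-<-trans z≤n k′<k) ¬prime
        x , n<x , seqₓ = SqProdSeq-exchange (<-≤-trans 0<m (maximal m seqₘ)) k′<k seqₖ seq′
    in <⇒≱ n<x (maximal x seqₓ)
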